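{- For every positive integer $n$ with $n \equiv 0 \pmod 4$ or $n \equiv 1 \pmod 4$, the transitive tournament $TT_n$ admits a chain--collider--fork decomposition consisting of exactly $\frac{1}{2}\left(\left\lceil \frac{n+1}{2}\right\rceil -1\right)$ colliders, $\frac{n(n-1)}{4} - \frac{1}{2}\left(\left\lceil \frac{n+1}{2}\right\rceil -1\right)$ chains, and $0$ forks.
   Context: The transitive tournament $TT_n$ has vertex set $\{v_1,\dots,v_n\}$ and arc set $\{(v_i,v_j): 1\le i<j\le n\}$ (an arc $(u,v)$ is written $u\to v$). A chain is a digraph on three distinct vertices with arcs $a\to b\to c$; a collider is one with arcs $a\to b\leftarrow c$; a fork is one with arcs $a\leftarrow b\to c$. A chain--collider--fork decomposition of $TT_n$ is a partition of the arc set of $TT_n$ into two-element sets of arcs, each of which forms (as a subdigraph) a chain, a collider, or a fork. -}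

module Defs where

open import Data.Nat using (ℕ; _<_; _/_; _*_; _∸_; _+_; ⌈_/2⌉; ⌊_/2⌋)
open import Data.Fin using (Fin; toℕ)
open import Data.Product using (_×_; _,_; proj₁; proj₂)
open import Data.Sum using (_⊎_)
open import Data.List using (List; []; _∷_; _++_; length)
open import Data.List.Membership.Propositional using (_∈_)
open import Data.List.Relation.Unary.All using (All)
open import Data.List.Relation.Unary.Unique.Propositional using (Unique)
open import Relation.Binary.PropositionalEquality using (_≡_; _≢_)

Arc : ℕ → Set
Arc n = Fin n × Fin n

IsArcTT : {n : ℕ} → Arc n → Set
IsArcTT (u , v) = toℕ u < toℕ v

data ChainArcs {n : ℕ} : Arc n → Arc n → Set where
  chain : ∀ {a b c} → a ≢ b → b ≢ c → a ≢ c → ChainArcs (a , b) (b , c)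

data ColliderArcs {n : ℕ} : Arc n → Arc n → Set where
  collider : ∀ {a b c} → a ≢ b → b ≢ c → a ≢ c → ColliderArcs (a , b) (c , b)

data ForkArcs {n : ℕ} : Arc n → Arc n → Set where
  fork : ∀ {a b c} → a ≢ b → b ≢ c → a ≢ c → ForkArcs (b , a) (b , c)

IsChain : {n : ℕ} → Arc n × Arc n → Set
IsChain (e , f) = ChainArcs e f ⊎ ChainArcs f e

IsCollider : {n : ℕ} → Arc n × Arc n → Set
IsCollider (e , f) = ColliderArcs e f

IsFork : {n : ℕ} → Arc n × Arc n → Set
IsFork (e , f) = ForkArcs e f

arcsOf : {n : ℕ} → List (Arc n × Arc n) → List (Arc n)
arcsOf [] = []
arcsOf ((e , f) ∷ ps) = e ∷ f ∷ arcsOf ps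

record CCFDecomposition (n : ℕ) : Set where
  field
    chains    : List (Arc n × Arc n)
    colliders : List (Arc n × Arc n)
    forks     : List (Arc n × Arc n)
    chainsOK    : All IsChain chains
    collidersOK : All IsCollider colliders
    forksOK     : All IsFork forks
  allArcs : List (Arc n)
  allArcs = arcsOf (chains ++ colliders ++ forks)
  field
    sound    : All IsArcTT allArcs
    complete : (a : Arc n) → IsArcTT a → a ∈ allArcs
    disjoint : Unique allArcs

-- ½(⌈(n+1)/2⌉ − 1)  (an integer when n ≡ 0,1 mod 4)
colliderCount : ℕ → ℕ
colliderCount n = ⌊ ⌈ n + 1 /2⌉ ∸ 1 /2⌋

chainCount : ℕ → ℕ
chainCount n = (n * (n ∸ 1)) / 4 ∸ colliderCount n

module Submission where

-- Induction from TT_n to TT_{n+4}: put two new sources s₁ < s₂ below a copy of TT_n and two new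
-- sinks t₁ < t₂ above it. The 4n + 6 new arcs split into the chains s₁→s₂→t₁ and s₁→t₁→t₂, the
-- chains s₁→m→t₁ and s₂→m→t₂ for every old vertex m, and the single collider s₁→t₂←s₂. Each step
-- thus adds one collider and no fork, starting from the empty decompositions of TT_0 and TT_1;
-- the number of chains then follows because every piece covers two of the n(n−1)/2 arcs.

open import Defs
open import Data.Empty using (⊥; ⊥-elim)
open import Data.Fin using (Fin; zero; suc; toℕ; fromℕ; inject₁)
open import Data.Fin.Properties using (toℕ<n; toℕ-fromℕ; toℕ-inject₁)
import Data.Fin.Relation.Unary.Top as Top
open import Data.List using (List; []; _∷_; _++_; map; concatMap; allFin; length)
open import Data.List.Properties
  using (∷-injectiveˡ; ++-assoc; map-++; map-∘; length-++; length-map; length-tabulate)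
open import Data.List.Membership.Propositional using (_∈_)
open import Data.List.Membership.Propositional.Properties
  using (∈-map⁺; ∈-++⁺ˡ; ∈-++⁺ʳ; ∈-concat⁺′; ∈-allFin)
open import Data.List.Relation.Binary.Disjoint.Propositional using (Disjoint)
open import Data.List.Relation.Binary.Permutation.Propositional
  using (_↭_; ↭-sym; ↭⇒↭ₛ; module PermutationReasoning)
open import Data.List.Relation.Binary.Permutation.Propositional.Properties
  using (All-resp-↭; ∈-resp-↭; shifts)
import Data.List.Relation.Binary.Permutation.Setoid.Properties as ↭ₛ
open import Data.List.Relation.Unary.All as All using (All; []; _∷_)
import Data.List.Relation.Unary.All.Properties as All
open import Data.List.Relation.Unary.AllPairs as AllPairs using ([]; _∷_)
import Data.List.Relation.Unary.AllPairs.Properties as AllPairs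
open import Data.List.Relation.Unary.Any using (here; there)
open import Data.List.Relation.Unary.Unique.Propositional using (Unique)
import Data.List.Relation.Unary.Unique.Propositional.Properties as Unique
open import Data.Nat using (ℕ; suc; _<_; _%_; _/_; _+_; _*_; _∸_; z<s; s<s; s<s⁻¹; ⌊_/2⌋)
open import Data.Nat.DivMod using (m*n/n≡m; [m+n]%n≡m%n)
open import Data.Nat.Properties
  using (+-comm; *-distribˡ-∸; *-identityʳ; m+n∸n≡m; <-irrefl; <-asym; <-trans; n<1+n; m<n⇒m<1+n)
open import Data.Nat.Tactic.RingSolver using (solve-∀)
open import Data.Product using (Σ; _×_; _,_; proj₁; proj₂; uncurry)
open import Data.Sum using (_⊎_; inj₁; inj₂)
open import Function using (_on_; _∘_; id)
open import Relation.Binary.PropositionalEquality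
  using (_≡_; _≢_; refl; sym; trans; cong; cong₂; subst; subst₂; setoid; module ≡-Reasoning)

private variable m n : ℕ

All-concatMap⁺ : ∀ {A B : Set} {P : B → Set} {f : A → List B} →
                 (∀ x → All P (f x)) → ∀ xs → All P (concatMap f xs)
All-concatMap⁺ Pf xs = All.concat⁺ (All.map⁺ (All.universal Pf xs))

Disjoint-by : ∀ {A B : Set} (f : A → B) {b : B} {xs ys : List A} →
              All (λ x → f x ≡ b) xs → All (λ y → f y ≢ b) ys → Disjoint xs ys
Disjoint-by f fxs≡b fys≢b (v∈xs , v∈ys) = All.lookup fys≢b v∈ys (All.lookup fxs≡b v∈xs)

arcsOf-++ : (ps qs : List (Arc n × Arc n)) → arcsOf (ps ++ qs) ≡ arcsOf ps ++ arcsOf qs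
arcsOf-++ []             qs = refl
arcsOf-++ ((e , f) ∷ ps) qs = cong (λ as → e ∷ f ∷ as) (arcsOf-++ ps qs)

arcsOf-move : (ps qs : List (Arc n × Arc n)) (p : Arc n × Arc n) (rs : List (Arc n × Arc n)) →
              arcsOf ((ps ++ qs) ++ p ∷ rs) ↭ arcsOf (p ∷ ps) ++ arcsOf (qs ++ rs)
arcsOf-move ps qs p@(e , f) rs = begin
  arcsOf ((ps ++ qs) ++ p ∷ rs)                  ≡⟨ arcsOf-++ (ps ++ qs) (p ∷ rs) ⟩
  arcsOf (ps ++ qs) ++ (e ∷ f ∷ []) ++ arcsOf rs ↭⟨ shifts (arcsOf (ps ++ qs)) (e ∷ f ∷ []) ⟩
  arcsOf (p ∷ ps ++ qs) ++ arcsOf rs             ≡⟨ arcsOf-++ (p ∷ ps ++ qs) rs ⟨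
  arcsOf ((p ∷ ps ++ qs) ++ rs)                  ≡⟨ cong arcsOf (++-assoc (p ∷ ps) qs rs) ⟩
  arcsOf (p ∷ ps ++ qs ++ rs)                    ≡⟨ arcsOf-++ (p ∷ ps) (qs ++ rs) ⟩
  arcsOf (p ∷ ps) ++ arcsOf (qs ++ rs)           ∎
  where open PermutationReasoning

mapArc : (Fin m → Fin n) → Arc m → Arc n
mapArc f (u , v) = f u , f v

mapPiece : (Fin m → Fin n) → Arc m × Arc m → Arc n × Arc n
mapPiece f (e , e′) = mapArc f e , mapArc f e′

arcsOf-map : (f : Fin m → Fin n) (ps : List (Arc m × Arc m)) →
             arcsOf (map (mapPiece f) ps) ≡ map (mapArc f) (arcsOf ps)
arcsOf-map f []              = refl
arcsOf-map f ((e , e′) ∷ ps) = cong (λ as → mapArc f e ∷ mapArc f e′ ∷ as) (arcsOf-map f ps)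

module _ {f : Fin m → Fin n} (f-injective : ∀ {u v} → f u ≡ f v → u ≡ v) where

  ChainArcs-map : ∀ {e e′} → ChainArcs e e′ → ChainArcs (mapArc f e) (mapArc f e′)
  ChainArcs-map (chain a≢b b≢c a≢c) = chain (a≢b ∘ f-injective) (b≢c ∘ f-injective) (a≢c ∘ f-injective)

  IsChain-mapPiece : ∀ {p} → IsChain p → IsChain (mapPiece f p)
  IsChain-mapPiece (inj₁ c) = inj₁ (ChainArcs-map c)
  IsChain-mapPiece (inj₂ c) = inj₂ (ChainArcs-map c)

  IsCollider-mapPiece : ∀ {p} → IsCollider p → IsCollider (mapPiece f p)
  IsCollider-mapPiece (collider a≢b b≢c a≢c) =
    collider (a≢b ∘ f-injective) (b≢c ∘ f-injective) (a≢c ∘ f-injective)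

  IsFork-mapPiece : ∀ {p} → IsFork p → IsFork (mapPiece f p)
  IsFork-mapPiece (fork a≢b b≢c a≢c) = fork (a≢b ∘ f-injective) (b≢c ∘ f-injective) (a≢c ∘ f-injective)

record EnumeratesArcs {V : Set} (_⊏_ : V → V → Set) (as : List (V × V)) : Set where
  field
    sound    : All (uncurry _⊏_) as
    complete : ∀ {u v} → u ⊏ v → (u , v) ∈ as
    unique   : Unique as

EnumeratesArcs-resp-↭ : ∀ {V : Set} {_⊏_ : V → V → Set} {as bs} →
                        as ↭ bs → EnumeratesArcs _⊏_ as → EnumeratesArcs _⊏_ bs
EnumeratesArcs-resp-↭ as↭bs e = record
  { sound    = All-resp-↭ as↭bs sound
  ; complete = ∈-resp-↭ as↭bs ∘ complete
  ; unique   = ↭ₛ.Unique-resp-↭ (setoid _) (↭⇒↭ₛ as↭bs) unique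
  }
  where open EnumeratesArcs e

enumeration : (D : CCFDecomposition n) → EnumeratesArcs (_<_ on toℕ) (CCFDecomposition.allArcs D)
enumeration D = record { sound = sound ; complete = complete _ ; unique = disjoint }
  where open CCFDecomposition D

-- Arcs of TT_{4+n} are handled as pairs of these named vertices, so that arcs with differently
-- named endpoints differ by constructors.
data Vertex (n : ℕ) : Set where
  s₁ s₂ : Vertex n
  inner : Fin n → Vertex n
  t₁ t₂ : Vertex n

position : Vertex n → Fin (4 + n)
position s₁        = zero
position s₂        = suc zero
position (inner m) = suc (suc (inject₁ (inject₁ m)))
position {n} t₁    = suc (suc (inject₁ (fromℕ n)))
position {n} t₂    = suc (suc (fromℕ (suc n)))

data Located {n : ℕ} : Fin (4 + n) → Set where
  at : (x : Vertex n) → Located (position x)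

locate : (v : Fin (4 + n)) → Located v
locate zero = at s₁
locate (suc zero) = at s₂
locate (suc (suc v)) with Top.view v
... | Top.‵fromℕ = at t₂
... | Top.‵inject₁ w with Top.view w
...   | Top.‵fromℕ     = at t₁
...   | Top.‵inject₁ m = at (inner m)

vertexAt : Fin (4 + n) → Vertex n
vertexAt v with locate v
... | at x = x

vertexAt-position : (x : Vertex n) → vertexAt (position x) ≡ x
vertexAt-position s₁ = refl
vertexAt-position s₂ = refl
vertexAt-position (inner m) rewrite Top.view-inject₁ (inject₁ m) | Top.view-inject₁ m = refl
vertexAt-position {n} t₁ rewrite Top.view-inject₁ (fromℕ n) | Top.view-fromℕ n = refl
vertexAt-position {n} t₂ rewrite Top.view-fromℕ (suc n) = refl

position-injective : ∀ {x y : Vertex n} → position x ≡ position y → x ≡ y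
position-injective {x = x} {y} eq = begin
  x                     ≡⟨ vertexAt-position x ⟨
  vertexAt (position x) ≡⟨ cong vertexAt eq ⟩
  vertexAt (position y) ≡⟨ vertexAt-position y ⟩
  y                     ∎
  where open ≡-Reasoning

rank : Vertex n → ℕ
rank s₁        = 0
rank s₂        = 1
rank (inner m) = 2 + toℕ m
rank {n} t₁    = 2 + n
rank {n} t₂    = 3 + n

toℕ-position : (x : Vertex n) → toℕ (position x) ≡ rank x
toℕ-position s₁        = refl
toℕ-position s₂        = refl
toℕ-position (inner m) = cong (2 +_) (trans (toℕ-inject₁ (inject₁ m)) (toℕ-inject₁ m))
toℕ-position {n} t₁    = cong (2 +_) (trans (toℕ-inject₁ (fromℕ n)) (toℕ-fromℕ n))
toℕ-position {n} t₂    = cong (2 +_) (toℕ-fromℕ (suc n))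

_≺_ : Vertex n → Vertex n → Set
_≺_ = _<_ on rank

inner≺t₁ : (m : Fin n) → inner m ≺ t₁
inner≺t₁ m = s<s (s<s (toℕ<n m))

inner≺t₂ : (m : Fin n) → inner m ≺ t₂
inner≺t₂ m = s<s (s<s (m<n⇒m<1+n (toℕ<n m)))

t₁≺t₂ : t₁ {n} ≺ t₂
t₁≺t₂ {n} = n<1+n (2 + n)

≺⇒position≢ : ∀ {x y : Vertex n} → x ≺ y → position x ≢ position y
≺⇒position≢ x≺y eq = <-irrefl (cong rank (position-injective eq)) x≺y

liftArc : Vertex n × Vertex n → Arc (4 + n)
liftArc (x , y) = position x , position y

liftArc-injective : ∀ {a b : Vertex n × Vertex n} → liftArc a ≡ liftArc b → a ≡ b
liftArc-injective eq =
  cong₂ _,_ (position-injective (cong proj₁ eq)) (position-injective (cong proj₂ eq))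

lift-enumeration : ∀ {as : List (Vertex n × Vertex n)} →
                   EnumeratesArcs _≺_ as → EnumeratesArcs (_<_ on toℕ) (map liftArc as)
lift-enumeration e = record
  { sound    = All.map⁺ (All.map (λ {(x , y)} → subst₂ _<_ (sym (toℕ-position x)) (sym (toℕ-position y)))
                                 sound)
  ; complete = complete′
  ; unique   = Unique.map⁺ liftArc-injective unique
  }
  where
  open EnumeratesArcs e
  complete′ : ∀ {u v} → toℕ u < toℕ v → (u , v) ∈ map liftArc _
  complete′ {u} {v} u<v with locate u | locate v
  ... | at x | at y = ∈-map⁺ liftArc (complete (subst₂ _<_ (toℕ-position x) (toℕ-position y) u<v))

boundaryArcs : List (Vertex n × Vertex n)
boundaryArcs = (s₁ , t₂) ∷ (s₂ , t₂) ∷ (s₁ , s₂) ∷ (s₂ , t₁) ∷ (s₁ , t₁) ∷ (t₁ , t₂) ∷ []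

star : Fin n → List (Vertex n × Vertex n)
star m = (s₁ , inner m) ∷ (inner m , t₁) ∷ (s₂ , inner m) ∷ (inner m , t₂) ∷ []

stars : (n : ℕ) → List (Vertex n × Vertex n)
stars n = concatMap star (allFin n)

newArcs : (n : ℕ) → List (Vertex n × Vertex n)
newArcs n = boundaryArcs ++ stars n

innerArc : Arc n → Vertex n × Vertex n
innerArc (u , v) = inner u , inner v

innerArc-injective : ∀ {a b : Arc n} → innerArc a ≡ innerArc b → a ≡ b
innerArc-injective refl = refl

newArcs-sound : All (uncurry _≺_) (newArcs n)
newArcs-sound {n} = All.++⁺ (z<s ∷ s<s z<s ∷ z<s ∷ s<s z<s ∷ z<s ∷ t₁≺t₂ ∷ [])
  (All-concatMap⁺ (λ m → z<s ∷ inner≺t₁ m ∷ s<s z<s ∷ inner≺t₂ m ∷ []) (allFin n))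

-- Arcs are told apart by their inner endpoints: boundary arcs have none, the arcs of star m
-- exactly m, and copies of old arcs two.
innerIndices : Vertex n → List (Fin n)
innerIndices (inner m) = m ∷ []
innerIndices _         = []

innerEndpoints : Vertex n × Vertex n → List (Fin n)
innerEndpoints (x , y) = innerIndices x ++ innerIndices y

star-disjoint : ∀ {m m′ : Fin n} → m ≢ m′ → Disjoint (star m) (star m′)
star-disjoint {m = m} {m′} m≢m′ =
  Disjoint-by innerEndpoints (refl ∷ refl ∷ refl ∷ refl ∷ []) (≢ ∷ ≢ ∷ ≢ ∷ ≢ ∷ [])
  where
  ≢ : m′ ∷ [] ≢ m ∷ []
  ≢ eq = m≢m′ (sym (∷-injectiveˡ eq))

unique-star : (m : Fin n) → Unique (star m)
unique-star _ = ((λ ()) ∷ (λ ()) ∷ (λ ()) ∷ []) ∷ ((λ ()) ∷ (λ ()) ∷ []) ∷ ((λ ()) ∷ []) ∷ [] ∷ []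

unique-boundaryArcs : Unique (boundaryArcs {n})
unique-boundaryArcs =
  ((λ ()) ∷ (λ ()) ∷ (λ ()) ∷ (λ ()) ∷ (λ ()) ∷ []) ∷ ((λ ()) ∷ (λ ()) ∷ (λ ()) ∷ (λ ()) ∷ []) ∷
  ((λ ()) ∷ (λ ()) ∷ (λ ()) ∷ []) ∷ ((λ ()) ∷ (λ ()) ∷ []) ∷ ((λ ()) ∷ []) ∷ [] ∷ []

unique-newArcs-++ : ∀ {as : List (Arc n)} → Unique as → Unique (newArcs n ++ map innerArc as)
unique-newArcs-++ {n} {as} as! =
  Unique.++⁺ unique-boundaryArcs
    (Unique.++⁺ unique-stars (Unique.map⁺ innerArc-injective as!) stars#old) boundary#rest
  where
  unique-stars : Unique (stars n)
  unique-stars = Unique.concat⁺ (All.map⁺ (All.universal unique-star (allFin n)))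
                                (AllPairs.map⁺ (AllPairs.map star-disjoint (Unique.allFin⁺ n)))
  stars#old : Disjoint (stars n) (map innerArc as)
  stars#old = Disjoint-by (length ∘ innerEndpoints)
                (All-concatMap⁺ (λ _ → refl ∷ refl ∷ refl ∷ refl ∷ []) (allFin n))
                (All.map⁺ (All.universal (λ _ ()) as))
  boundary#rest : Disjoint boundaryArcs (stars n ++ map innerArc as)
  boundary#rest = Disjoint-by (length ∘ innerEndpoints) (refl ∷ refl ∷ refl ∷ refl ∷ refl ∷ refl ∷ [])
                    (All.++⁺ (All-concatMap⁺ (λ _ → (λ ()) ∷ (λ ()) ∷ (λ ()) ∷ (λ ()) ∷ []) (allFin n))
                             (All.map⁺ (All.universal (λ _ ()) as)))

complete-newArcs-++ : ∀ {as : List (Arc n)} → (∀ {u v} → toℕ u < toℕ v → (u , v) ∈ as) →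
                      ∀ {x y} → x ≺ y → (x , y) ∈ newArcs n ++ map innerArc as
complete-newArcs-++ {n} {as} complete = complete′
  where
  boundary∈ : ∀ {a} → a ∈ boundaryArcs → a ∈ newArcs n ++ map innerArc as
  boundary∈ a∈ = ∈-++⁺ˡ (∈-++⁺ˡ {ys = stars n} a∈)
  star∈ : ∀ {a} m → a ∈ star m → a ∈ newArcs n ++ map innerArc as
  star∈ m a∈ = ∈-++⁺ˡ (∈-++⁺ʳ boundaryArcs (∈-concat⁺′ a∈ (∈-map⁺ star (∈-allFin m))))
  complete′ : ∀ {x y} → x ≺ y → (x , y) ∈ newArcs n ++ map innerArc as
  complete′ {s₁}      {s₂}      _   = boundary∈ (there (there (here refl)))
  complete′ {s₁}      {inner m} _   = star∈ m (here refl)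
  complete′ {s₁}      {t₁}      _   = boundary∈ (there (there (there (there (here refl)))))
  complete′ {s₁}      {t₂}      _   = boundary∈ (here refl)
  complete′ {s₂}      {inner m} _   = star∈ m (there (there (here refl)))
  complete′ {s₂}      {t₁}      _   = boundary∈ (there (there (there (here refl))))
  complete′ {s₂}      {t₂}      _   = boundary∈ (there (here refl))
  complete′ {inner u} {inner v} u≺v = ∈-++⁺ʳ (newArcs n) (∈-map⁺ innerArc (complete (s<s⁻¹ (s<s⁻¹ u≺v))))
  complete′ {inner m} {t₁}      _   = star∈ m (there (here refl))
  complete′ {inner m} {t₂}      _   = star∈ m (there (there (there (here refl))))
  complete′ {t₁}      {t₂}      _   = boundary∈ (there (there (there (there (there (here refl))))))
  complete′ {t₁}      {inner m} t≺m = ⊥-elim (<-asym t≺m (inner≺t₁ m))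
  complete′ {t₂}      {inner m} t≺m = ⊥-elim (<-asym t≺m (inner≺t₂ m))
  complete′ {t₂}      {t₁}      t≺t = ⊥-elim (<-asym t≺t t₁≺t₂)
  complete′ {t₁}      {t₁}      t≺t = ⊥-elim (<-irrefl refl t≺t)
  complete′ {t₂}      {t₂}      t≺t = ⊥-elim (<-irrefl refl t≺t)
  complete′ {_}       {s₁}      ()
  complete′ {s₂}      {s₂}      (s<s ())
  complete′ {inner _} {s₂}      (s<s ())
  complete′ {t₁}      {s₂}      (s<s ())
  complete′ {t₂}      {s₂}      (s<s ())

extend-enumeration : ∀ {as : List (Arc n)} → EnumeratesArcs (_<_ on toℕ) as →
                     EnumeratesArcs _≺_ (newArcs n ++ map innerArc as)
extend-enumeration e = record
  { sound    = All.++⁺ newArcs-sound (All.map⁺ (All.map (λ u<v → s<s (s<s u<v)) sound))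
  ; complete = complete-newArcs-++ complete
  ; unique   = unique-newArcs-++ unique
  }
  where open EnumeratesArcs e

chainVia : Vertex n → Vertex n → Vertex n → Arc (4 + n) × Arc (4 + n)
chainVia x y z = liftArc (x , y) , liftArc (y , z)

chainVia-isChain : ∀ (x y z : Vertex n) → x ≺ y → y ≺ z → IsChain (chainVia x y z)
chainVia-isChain _ _ _ x≺y y≺z =
  inj₁ (chain (≺⇒position≢ x≺y) (≺⇒position≢ y≺z) (≺⇒position≢ (<-trans x≺y y≺z)))

chainsThrough : Fin n → List (Arc (4 + n) × Arc (4 + n))
chainsThrough m = chainVia s₁ (inner m) t₁ ∷ chainVia s₂ (inner m) t₂ ∷ []

newChains : (n : ℕ) → List (Arc (4 + n) × Arc (4 + n))
newChains n = chainVia s₁ s₂ t₁ ∷ chainVia s₁ t₁ t₂ ∷ concatMap chainsThrough (allFin n)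

newCollider : (n : ℕ) → Arc (4 + n) × Arc (4 + n)
newCollider n = liftArc (s₁ , t₂) , liftArc (s₂ , t₂)

newChains-areChains : All IsChain (newChains n)
newChains-areChains {n} =
  chainVia-isChain s₁ s₂ t₁ z<s (s<s z<s) ∷ chainVia-isChain s₁ t₁ t₂ z<s t₁≺t₂ ∷
  All-concatMap⁺ (λ m → chainVia-isChain s₁ (inner m) t₁ z<s (inner≺t₁ m) ∷
                        chainVia-isChain s₂ (inner m) t₂ (s<s z<s) (inner≺t₂ m) ∷ []) (allFin n)

newCollider-isCollider : IsCollider (newCollider n)
newCollider-isCollider = collider (λ ()) (λ ()) (λ ())

length-newChains : ∀ n → length (newChains n) ≡ 2 + n * 2
length-newChains n =
  cong (2 +_) (trans (length-chainsThrough (allFin n)) (cong (_* 2) (length-tabulate {n = n} id)))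
  where
  length-chainsThrough : (ms : List (Fin n)) → length (concatMap chainsThrough ms) ≡ length ms * 2
  length-chainsThrough []       = refl
  length-chainsThrough (_ ∷ ms) = cong (2 +_) (length-chainsThrough ms)

arcsOf-newPieces : ∀ n → arcsOf (newCollider n ∷ newChains n) ≡ map liftArc (newArcs n)
arcsOf-newPieces n = cong (λ as → liftArc (s₁ , t₂) ∷ liftArc (s₂ , t₂) ∷ liftArc (s₁ , s₂) ∷
                                   liftArc (s₂ , t₁) ∷ liftArc (s₁ , t₁) ∷ liftArc (t₁ , t₂) ∷ as)
                          (arcsOf-chainsThrough (allFin n))
  where
  arcsOf-chainsThrough : (ms : List (Fin n)) →
                         arcsOf (concatMap chainsThrough ms) ≡ map liftArc (concatMap star ms)
  arcsOf-chainsThrough []       = refl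
  arcsOf-chainsThrough (m ∷ ms) = cong (λ as → liftArc (s₁ , inner m) ∷ liftArc (inner m , t₁) ∷
                                                liftArc (s₂ , inner m) ∷ liftArc (inner m , t₂) ∷ as)
                                       (arcsOf-chainsThrough ms)

embed : Fin n → Fin (4 + n)
embed = position ∘ inner

embed-injective : ∀ {u v : Fin n} → embed u ≡ embed v → u ≡ v
embed-injective eq with position-injective {x = inner _} {y = inner _} eq
... | refl = refl

copies : List (Arc n × Arc n) → List (Arc (4 + n) × Arc (4 + n))
copies = map (mapPiece embed)

arcsOf-extension : (chs cls fks : List (Arc n × Arc n)) →
  arcsOf ((newChains n ++ copies chs) ++ newCollider n ∷ copies cls ++ copies fks)
    ↭ map liftArc (newArcs n ++ map innerArc (arcsOf (chs ++ cls ++ fks)))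
arcsOf-extension {n} chs cls fks = begin
  arcsOf ((newChains n ++ copies chs) ++ newCollider n ∷ copies cls ++ copies fks)
    ↭⟨ arcsOf-move (newChains n) (copies chs) (newCollider n) (copies cls ++ copies fks) ⟩
  arcsOf (newCollider n ∷ newChains n) ++ arcsOf (copies chs ++ copies cls ++ copies fks)
    ≡⟨ cong₂ _++_ (arcsOf-newPieces n) (cong arcsOf copies-++) ⟩
  map liftArc (newArcs n) ++ arcsOf (copies (chs ++ cls ++ fks))
    ≡⟨ cong (map liftArc (newArcs n) ++_) (trans (arcsOf-map embed _) (map-∘ _)) ⟩
  map liftArc (newArcs n) ++ map liftArc (map innerArc (arcsOf (chs ++ cls ++ fks)))
    ≡⟨ map-++ liftArc (newArcs n) _ ⟨
  map liftArc (newArcs n ++ map innerArc (arcsOf (chs ++ cls ++ fks))) ∎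
  where
  open PermutationReasoning
  copies-++ : copies chs ++ copies cls ++ copies fks ≡ copies (chs ++ cls ++ fks)
  copies-++ = trans (cong (copies chs ++_) (sym (map-++ _ cls fks))) (sym (map-++ _ chs (cls ++ fks)))

extend : CCFDecomposition n → CCFDecomposition (4 + n)
extend {n} D = record
  { chains      = newChains n ++ copies chains
  ; colliders   = newCollider n ∷ copies colliders
  ; forks       = copies forks
  ; chainsOK    = All.++⁺ newChains-areChains (All.map⁺ (All.map (IsChain-mapPiece embed-injective) chainsOK))
  ; collidersOK = newCollider-isCollider ∷ All.map⁺ (All.map (IsCollider-mapPiece embed-injective) collidersOK)
  ; forksOK     = All.map⁺ (All.map (IsFork-mapPiece embed-injective) forksOK)
  ; sound       = E.sound
  ; complete    = λ _ → E.complete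
  ; disjoint    = E.unique
  }
  where
  open CCFDecomposition D
  module E = EnumeratesArcs (EnumeratesArcs-resp-↭ (↭-sym (arcsOf-extension chains colliders forks))
                                                   (lift-enumeration (extend-enumeration (enumeration D))))

colliderCount≡⌊⌊n/2⌋/2⌋ : ∀ n → colliderCount n ≡ ⌊ ⌊ n /2⌋ /2⌋
colliderCount≡⌊⌊n/2⌋/2⌋ n = cong (λ k → ⌊ ⌊ suc k /2⌋ ∸ 1 /2⌋) (+-comm n 1)

colliderCount[4+n]≡1+colliderCount[n] : ∀ n → colliderCount (4 + n) ≡ suc (colliderCount n)
colliderCount[4+n]≡1+colliderCount[n] n =
  trans (colliderCount≡⌊⌊n/2⌋/2⌋ (4 + n)) (cong suc (sym (colliderCount≡⌊⌊n/2⌋/2⌋ n)))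

pieceCount-step : ∀ n c k → (c + k) * 4 + n ≡ n * n →
                  (2 + n * 2 + c + suc k) * 4 + (4 + n) ≡ (4 + n) * (4 + n)
pieceCount-step n c k h = begin
  (2 + n * 2 + c + suc k) * 4 + (4 + n) ≡⟨ expand n c k ⟩
  ((c + k) * 4 + n) + (n * 8 + 16)      ≡⟨ cong (_+ (n * 8 + 16)) h ⟩
  n * n + (n * 8 + 16)                  ≡⟨ square n ⟩
  (4 + n) * (4 + n)                     ∎
  where
  open ≡-Reasoning
  expand : ∀ n c k → (2 + n * 2 + c + suc k) * 4 + (4 + n) ≡ ((c + k) * 4 + n) + (n * 8 + 16)
  expand = solve-∀
  square : ∀ n → n * n + (n * 8 + 16) ≡ (4 + n) * (4 + n)
  square = solve-∀

chainCount-from-pieces : ∀ n c k → (c + k) * 4 + n ≡ n * n → k ≡ colliderCount n → chainCount n ≡ c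
chainCount-from-pieces n c k h k≡ = begin
  chainCount n            ≡⟨ cong (n * (n ∸ 1) / 4 ∸_) k≡ ⟨
  n * (n ∸ 1) / 4 ∸ k     ≡⟨ cong (λ x → x / 4 ∸ k) n[n-1]≡[c+k]*4 ⟩
  (c + k) * 4 / 4 ∸ k     ≡⟨ cong (_∸ k) (m*n/n≡m (c + k) 4) ⟩
  c + k ∸ k               ≡⟨ m+n∸n≡m c k ⟩
  c                       ∎
  where
  open ≡-Reasoning
  n[n-1]≡[c+k]*4 : n * (n ∸ 1) ≡ (c + k) * 4
  n[n-1]≡[c+k]*4 = begin
    n * (n ∸ 1)           ≡⟨ *-distribˡ-∸ n n 1 ⟩
    n * n ∸ n * 1         ≡⟨ cong (n * n ∸_) (*-identityʳ n) ⟩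
    n * n ∸ n             ≡⟨ cong (_∸ n) h ⟨
    (c + k) * 4 + n ∸ n   ≡⟨ m+n∸n≡m _ n ⟩
    (c + k) * 4           ∎

record Census (D : CCFDecomposition n) : Set where
  open CCFDecomposition D
  field
    noForks    : length forks ≡ 0
    colliders≡ : length colliders ≡ colliderCount n
    -- 4 · #pieces = n(n − 1): the pieces pair up the n(n − 1)/2 arcs
    pieces     : (length chains + length colliders) * 4 + n ≡ n * n

extend-census : {D : CCFDecomposition n} → Census D → Census (extend D)
extend-census {n} {D} c = record
  { noForks    = trans (length-map _ forks) noForks
  ; colliders≡ = trans (cong suc (trans colliders′≡ colliders≡)) (sym (colliderCount[4+n]≡1+colliderCount[n] n))
  ; pieces     = subst₂ (λ c k → (c + k) * 4 + (4 + n) ≡ (4 + n) * (4 + n))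
                        (sym chains′≡) (cong suc (sym colliders′≡))
                        (pieceCount-step n (length chains) (length colliders) pieces)
  }
  where
  open CCFDecomposition D
  open Census c
  colliders′≡ : length (copies colliders) ≡ length colliders
  colliders′≡ = length-map _ colliders
  chains′≡ : length (newChains n ++ copies chains) ≡ 2 + n * 2 + length chains
  chains′≡ = trans (length-++ (newChains n)) (cong₂ _+_ (length-newChains n) (length-map _ chains))

arclessDecomposition : (∀ {u v : Fin n} → toℕ u < toℕ v → ⊥) → CCFDecomposition n
arclessDecomposition noArc = record
  { chains = [] ; colliders = [] ; forks = [] ; chainsOK = [] ; collidersOK = [] ; forksOK = []
  ; sound = [] ; complete = λ _ u<v → ⊥-elim (noArc u<v) ; disjoint = [] }

[4+n]%4≡n%4 : ∀ n → (4 + n) % 4 ≡ n % 4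
[4+n]%4≡n%4 n = trans (cong (_% 4) (+-comm 4 n)) ([m+n]%n≡m%n n 4)

decomposition : ∀ n → n % 4 ≡ 0 ⊎ n % 4 ≡ 1 → Σ (CCFDecomposition n) Census
decomposition 0 _ = arclessDecomposition (λ { {()} }) , record { noForks = refl ; colliders≡ = refl ; pieces = refl }
decomposition 1 _ =
  arclessDecomposition (λ { {zero} {zero} () }) , record { noForks = refl ; colliders≡ = refl ; pieces = refl }
decomposition 2 (inj₁ ())
decomposition 2 (inj₂ ())
decomposition 3 (inj₁ ())
decomposition 3 (inj₂ ())
decomposition (suc (suc (suc (suc n)))) n%4∈01
  with decomposition n (subst (λ r → r ≡ 0 ⊎ r ≡ 1) ([4+n]%4≡n%4 n) n%4∈01)
... | D , census = extend D , extend-census census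

mainTheorem3 : (n : ℕ) → 0 < n → (n % 4 ≡ 0 ⊎ n % 4 ≡ 1) →
    Σ (CCFDecomposition n) (λ D →
      length (CCFDecomposition.colliders D) ≡ colliderCount n
      × length (CCFDecomposition.chains D) ≡ chainCount n
      × length (CCFDecomposition.forks D) ≡ 0)
mainTheorem3 n _ n%4∈01 with decomposition n n%4∈01
... | D , census = D , colliders≡ , sym (chainCount-from-pieces n _ _ pieces colliders≡) , noForks
  where open Census census
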